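{- Let $D'$ be a balanced bipartite digraph with colour classes $X'$ and $Y'$ of cardinalities $a'$, where $a'\geq 2$, and let $M'$ be a complete matching from $X'$ to $Y'$ in $D'$. Suppose that $$d_{D'}(x')+d_{D'}(y')+d_{D'}(x'')+d_{D'}(y'')\geq 6a'+2$$ for all pairwise distinct $x',x''\in X'$ and $y',y''\in Y'$ such that $D'$ contains $M'$-compatible paths from $x'$ to $y'$ and from $x''$ to $y''$. If $a'\geq 3$, then $D'$ contains an $M'$-compatible cycle of length at least $a'$. If $a'=2$, then $D'$ contains a cycle of length $4$ compatible with some matching from $X'$ to $Y'$.
   Context: A digraph has a finite vertex set and a set of arcs (ordered pairs of distinct vertices), with no loops or multiple arcs. $d_{D'}(v)$ is the sum of the outdegree and indegree of $v$ in $D'$. Bipartite with colour classes $X',Y'$ means $V(D')=X'\sqcup Y'$ and all arcs go between $X'$ and $Y'$; balanced means $|X'|=|Y'|$. A matching from $X'$ to $Y'$ is a set of pairwise vertex-disjoint arcs each with origin in $X'$ and terminus in $Y'$; it is complete if it has $|X'|$ arcs. An oriented path or cycle is compatible with a matching $M'$ ($M'$-compatible) if its arcs are alternately in $M'$ and not in $M'$. Paths and cycles are oriented. -}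

module Defs where

open import Data.Nat using (ℕ; zero; suc; _+_)
open import Data.Fin using (Fin; zero; suc)
open import Data.Bool using (Bool; true; false; _≟_)
open import Data.Sum using (_⊎_; inj₁; inj₂)
open import Data.Product using (_×_; _,_; Σ; ∃)
open import Data.List using (List; []; _∷_; _++_; map)
open import Data.List.Relation.Unary.All using (All)
open import Data.List.Relation.Unary.Unique.Propositional using (Unique)
open import Data.Empty using (⊥)
open import Data.Unit using (⊤)
open import Relation.Binary.PropositionalEquality using (_≡_; _≢_)

b2n : Bool → ℕ
b2n true = 1
b2n false = 0

count : ∀ {n} → (Fin n → Bool) → ℕ
count {zero} f = 0
count {suc n} f = b2n (f zero) + count (λ i → f (suc i))

sumFin : ∀ {n} → (Fin n → ℕ) → ℕ
sumFin {zero} g = 0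
sumFin {suc n} g = g zero + sumFin (λ i → g (suc i))

-- A bipartite digraph with colour classes X' = Y' = Fin a (balanced):
-- vertices are inj₁ x (x ∈ X') and inj₂ y (y ∈ Y');
-- xy x y ≡ true iff arc x → y, yx y x ≡ true iff arc y → x.
record BDigraph (a : ℕ) : Set where
  field
    xy : Fin a → Fin a → Bool
    yx : Fin a → Fin a → Bool
open BDigraph public

Vtx : ℕ → Set
Vtx a = Fin a ⊎ Fin a

Arc : ∀ {a} → BDigraph a → Vtx a → Vtx a → Set
Arc D (inj₁ x) (inj₂ y) = xy D x y ≡ true
Arc D (inj₂ y) (inj₁ x) = yx D y x ≡ true
Arc D (inj₁ _) (inj₁ _) = ⊥
Arc D (inj₂ _) (inj₂ _) = ⊥

deg : ∀ {a} → BDigraph a → Vtx a → ℕ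
deg D (inj₁ x) = count (λ y → xy D x y) + count (λ y → yx D y x)
deg D (inj₂ y) = count (λ x → yx D y x) + count (λ x → xy D x y)

record Matching {a : ℕ} (D : BDigraph a) : Set where
  field
    rel : Fin a → Fin a → Bool
    sub : ∀ x y → rel x y ≡ true → xy D x y ≡ true
    uniqY : ∀ x y y′ → rel x y ≡ true → rel x y′ ≡ true → y ≡ y′
    uniqX : ∀ x x′ y → rel x y ≡ true → rel x′ y ≡ true → x ≡ x′
open Matching public

size : ∀ {a} {D : BDigraph a} → Matching D → ℕ
size M = sumFin (λ x → count (λ y → rel M x y))

Complete : ∀ {a} {D : BDigraph a} → Matching D → Set
Complete {a} M = size M ≡ a

inM : ∀ {a} {D : BDigraph a} → Matching D → Vtx a → Vtx a → Bool
inM M (inj₁ x) (inj₂ y) = rel M x y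
inM M _ _ = false

steps : ∀ {A : Set} → List A → List (A × A)
steps [] = []
steps (u ∷ []) = []
steps (u ∷ v ∷ vs) = (u , v) ∷ steps (v ∷ vs)

Alternating : List Bool → Set
Alternating [] = ⊤
Alternating (b ∷ []) = ⊤
Alternating (b ∷ c ∷ bs) = (b ≢ c) × Alternating (c ∷ bs)

ArcAt : ∀ {a} → BDigraph a → Vtx a × Vtx a → Set
ArcAt D (u , v) = Arc D u v

inMAt : ∀ {a} {D : BDigraph a} → Matching D → Vtx a × Vtx a → Bool
inMAt M (u , v) = inM M u v

IsMPath : ∀ {a} (D : BDigraph a) → Matching D → List (Vtx a) → Set
IsMPath D M vs =
  Unique vs × All (ArcAt D) (steps vs) × Alternating (map (inMAt M) (steps vs))

MPathFromTo : ∀ {a} (D : BDigraph a) → Matching D → Vtx a → Vtx a → Set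
MPathFromTo D M u w = ∃ λ vs → IsMPath D M (u ∷ vs ++ w ∷ [])

-- v ∷ vs is an (oriented) M-compatible cycle v → v₁ → … → vₖ → v:
-- at least 2 distinct vertices, arcs along the closed sequence, and the
-- arcs alternate cyclically (including the last arc vs. the first arc).
IsMCycle : ∀ {a} (D : BDigraph a) → Matching D → List (Vtx a) → Set
IsMCycle D M [] = ⊥
IsMCycle D M (v ∷ []) = ⊥
IsMCycle D M (v ∷ w ∷ vs) =
  let cs = steps (v ∷ w ∷ vs ++ v ∷ []) in
  Unique (v ∷ w ∷ vs) × All (ArcAt D) cs
    × Alternating (map (inMAt M) (cs ++ (v , w) ∷ []))

module Submission where

-- A complete matching is a bijection σ : X' → Y'.  Contracting each matched
-- pair x_i σ(i) to i gives the digraph H on Fin a with i → j iff σ(i) → x_j;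
-- paths and cycles of H expand into M-compatible paths and cycles of D of
-- twice the length.  Put t = ⌊(a - 1)/2⌋.  Every in-neighbour of the start
-- of a maximal path of H (avoiding a vertex set E) lies on the path; lying
-- beyond its first t vertices it closes a cycle of length > t.  So without
-- such a cycle the start has in-degree ≤ t + |E|, and dually the end has
-- out-degree ≤ t + |E|.  Among a maximal path and maximal paths avoiding its
-- start resp. its end, two have distinct starts and distinct ends with these
-- degrees totalling ≤ 4t + 2 ≤ 2a, against the degree condition.  Hence H has
-- a cycle longer than t, which expands to the required cycle (this works
-- for every a ≥ 2).  For a = 2 the degree condition leaves at most one of
-- the 8 possible arcs missing, so one of two arc-disjoint 4-cycles survives.

open import Defs
open import Data.Bool using (Bool; true; false; not; _∨_)
open import Data.Bool.Properties using () renaming (_≟_ to _≟B_)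
open import Data.Empty using (⊥; ⊥-elim)
open import Data.Fin using (Fin; zero; suc; punchOut)
open import Data.Fin.Properties using (any?; injective⇒≤; punchOut-injective)
  renaming (suc-injective to Fin-suc-injective; _≟_ to _≟F_)
open import Data.List using (List; []; _∷_; _++_; length; take; reverse; map)
open import Data.List.Membership.Propositional using (_∈_; _∉_)
open import Data.List.Membership.Propositional.Properties using (∈-++⁺ˡ; ∈-++⁺ʳ; ∈-∃++)
import Data.List.Membership.DecPropositional as DecMembership
open import Data.List.Properties
  using (∷-injectiveʳ; length-++; length-take; ++-assoc; reverse-++; unfold-reverse; length-reverse)
open import Data.List.Relation.Unary.All as All using (All; []; _∷_)
import Data.List.Relation.Unary.All.Properties as AllProps
open import Data.List.Relation.Unary.AllPairs using ([]; _∷_)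
open import Data.List.Relation.Unary.Any using (here; there)
open import Data.List.Relation.Unary.Linked as Linked using (Linked; []; [-]; _∷_)
open import Data.List.Relation.Unary.Unique.Propositional using (Unique)
import Data.List.Relation.Unary.Unique.Propositional.Properties as UniqueProps
open import Data.Nat using (ℕ; zero; suc; _+_; _*_; _≤_; _<_; _⊓_; z≤n; s≤s)
open import Data.Nat.ListAction using (sum)
open import Data.Nat.Properties
open import Algebra.Properties.CommutativeSemigroup +-commutativeSemigroup using (interchange)
open import Data.Nat.Tactic.RingSolver using (solve-∀)
open import Data.Product using (_×_; _,_; ∃; proj₁; proj₂)
open import Data.Sum using (_⊎_; inj₁; inj₂; map₂)
open import Data.Sum.Properties using (inj₂-injective)
open import Data.Unit using (⊤; tt)
open import Function.Base using (case_of_; _∘_)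
open import Function.Definitions using (Injective)
open import Relation.Binary.PropositionalEquality
open import Relation.Nullary using (Dec; yes; no; does)
open import Relation.Nullary.Decidable using (dec-true; dec-false; decidable-stable; ¬?; _×-dec_)

b2n≤1 : ∀ b → b2n b ≤ 1
b2n≤1 true  = ≤-refl
b2n≤1 false = z≤n

count≤ : ∀ {n} (f : Fin n → Bool) → count f ≤ n
count≤ {zero}  f = z≤n
count≤ {suc n} f = +-mono-≤ (b2n≤1 (f zero)) (count≤ (λ i → f (suc i)))

b2n-mono : ∀ {b c} → (b ≡ true → c ≡ true) → b2n b ≤ b2n c
b2n-mono {false} _ = z≤n
b2n-mono {true}  f rewrite f refl = ≤-refl

count-mono : ∀ {n} {f g : Fin n → Bool} → (∀ i → f i ≡ true → g i ≡ true) →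
  count f ≤ count g
count-mono {zero}  f⇒g = z≤n
count-mono {suc n} f⇒g = +-mono-≤ (b2n-mono (f⇒g zero)) (count-mono (λ i → f⇒g (suc i)))

count-strict : ∀ {n} {f g : Fin n → Bool} → (∀ i → f i ≡ true → g i ≡ true) →
  (k : Fin n) → f k ≡ false → g k ≡ true → count f < count g
count-strict {suc n} f⇒g zero fk gk rewrite fk | gk =
  s≤s (count-mono (λ i → f⇒g (suc i)))
count-strict {suc n} {f} {g} f⇒g (suc k) fk gk = begin-strict
  b2n (f zero) + count (λ i → f (suc i))
    <⟨ +-monoʳ-< (b2n (f zero)) (count-strict (λ i → f⇒g (suc i)) k fk gk) ⟩
  b2n (f zero) + count (λ i → g (suc i))
    ≤⟨ +-monoˡ-≤ (count (λ i → g (suc i))) (b2n-mono (f⇒g zero)) ⟩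
  b2n (g zero) + count (λ i → g (suc i))  ∎
  where open ≤-Reasoning

count-none : ∀ {n} (f : Fin n → Bool) → (∀ i → f i ≡ false) → count f ≡ 0
count-none {zero}  f none = refl
count-none {suc n} f none rewrite none zero = count-none (λ i → f (suc i)) (λ i → none (suc i))

count-∨ : ∀ {n} (f g : Fin n → Bool) → count (λ i → f i ∨ g i) ≤ count f + count g
count-∨ {zero}  f g = z≤n
count-∨ {suc n} f g = begin
  b2n (f zero ∨ g zero) + count (λ i → f (suc i) ∨ g (suc i))
    ≤⟨ +-mono-≤ (b2n-∨ (f zero) (g zero)) (count-∨ (λ i → f (suc i)) (λ i → g (suc i))) ⟩
  (b2n (f zero) + b2n (g zero)) + (count (λ i → f (suc i)) + count (λ i → g (suc i)))
    ≡⟨ interchange (b2n (f zero)) (b2n (g zero)) _ _ ⟩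
  (b2n (f zero) + count (λ i → f (suc i))) + (b2n (g zero) + count (λ i → g (suc i)))  ∎
  where
  open ≤-Reasoning
  b2n-∨ : ∀ b c → b2n (b ∨ c) ≤ b2n b + b2n c
  b2n-∨ true  c = s≤s z≤n
  b2n-∨ false c = ≤-refl

count-atMostOne : ∀ {n} (f : Fin n → Bool) →
  (∀ i j → f i ≡ true → f j ≡ true → i ≡ j) → count f ≤ 1
count-atMostOne {zero}  f unique = z≤n
count-atMostOne {suc n} f unique with f zero in f0
... | true  = ≤-reflexive (cong suc (count-none _ others-false))
  where
  others-false : ∀ i → f (suc i) ≡ false
  others-false i with f (suc i) in fi
  ... | true  = case unique zero (suc i) f0 fi of λ ()
  ... | false = refl
... | false = count-atMostOne (λ i → f (suc i))
  (λ i j fi fj → Fin-suc-injective (unique (suc i) (suc j) fi fj))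

count-witness : ∀ {n} (f : Fin n → Bool) → 0 < count f → ∃ λ i → f i ≡ true
count-witness {suc n} f pos with f zero in f0
... | true  = zero , f0
... | false = let i , fi = count-witness (λ i → f (suc i)) pos in suc i , fi

_∈?_ : ∀ {m} (j : Fin m) (L : List (Fin m)) → Dec (j ∈ L)
_∈?_ = DecMembership._∈?_ _≟F_

_∈ᵇ_ : ∀ {m} → Fin m → List (Fin m) → Bool
j ∈ᵇ L = does (j ∈? L)

count-preimage : ∀ {n m} (g : Fin n → Fin m) → Injective _≡_ _≡_ g →
  (L : List (Fin m)) → count (λ i → g i ∈ᵇ L) ≤ length L
count-preimage g g-inj [] = ≤-reflexive (count-none (λ i → g i ∈ᵇ []) (λ _ → refl))
count-preimage g g-inj (l ∷ L) = ≤-trans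
  (count-∨ (λ i → does (g i ≟F l)) (λ i → g i ∈ᵇ L))
  (+-mono-≤ (count-atMostOne _ hits-l-once) (count-preimage g g-inj L))
  where
  hits-l-once : ∀ i j → does (g i ≟F l) ≡ true → does (g j ≟F l) ≡ true → i ≡ j
  hits-l-once i j p q with g i ≟F l | g j ≟F l
  ... | yes gi≡l | yes gj≡l = g-inj (trans gi≡l (sym gj≡l))

count≤length : ∀ {n m} {f : Fin n → Bool} (g : Fin n → Fin m) →
  Injective _≡_ _≡_ g → (L : List (Fin m)) →
  (∀ i → f i ≡ true → g i ∈ L) → count f ≤ length L
count≤length g g-inj L f⇒∈ = ≤-trans
  (count-mono (λ i fi → dec-true (g i ∈? L) (f⇒∈ i fi)))
  (count-preimage g g-inj L)

sumFin≤ : ∀ {n} (g : Fin n → ℕ) → (∀ i → g i ≤ 1) → sumFin g ≤ n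
sumFin≤ {zero}  g ≤1 = z≤n
sumFin≤ {suc n} g ≤1 = +-mono-≤ (≤1 zero) (sumFin≤ (λ i → g (suc i)) (λ i → ≤1 (suc i)))

sumFin-saturated : ∀ {n} (g : Fin n → ℕ) → (∀ i → g i ≤ 1) → n ≤ sumFin g →
  ∀ i → 1 ≤ g i
sumFin-saturated {suc n} g ≤1 full zero = +-cancelʳ-≤ n 1 (g zero)
  (≤-trans full (+-monoʳ-≤ (g zero) (sumFin≤ (λ i → g (suc i)) (λ i → ≤1 (suc i)))))
sumFin-saturated {suc n} g ≤1 full (suc i) =
  sumFin-saturated (λ i → g (suc i)) (λ i → ≤1 (suc i))
    (≤-pred (≤-trans full (+-monoˡ-≤ _ (≤1 zero)))) i

-- An injective self-map of Fin n is surjective: otherwise, punching out a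
-- missed value y would inject Fin (suc m) into Fin m.
injective⇒surjective : ∀ {n} (f : Fin n → Fin n) → Injective _≡_ _≡_ f →
  ∀ y → ∃ λ x → f x ≡ y
injective⇒surjective {suc m} f f-inj y with any? (λ x → f x ≟F y)
... | yes hit = hit
... | no miss = ⊥-elim (<-irrefl refl (injective⇒≤ {f = squeeze} squeeze-injective))
  where
  y≢f : ∀ x → y ≢ f x
  y≢f x y≡fx = miss (x , sym y≡fx)
  squeeze : Fin (suc m) → Fin m
  squeeze x = punchOut (y≢f x)
  squeeze-injective : Injective _≡_ _≡_ squeeze
  squeeze-injective eq = f-inj (punchOut-injective (y≢f _) (y≢f _) eq)

-- A complete matching M of D is perfect: it matches every x ∈ X' to a
-- unique partner σ x ∈ Y', and σ is a bijection with inverse τ.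
module Perfect {a : ℕ} {D : BDigraph a} (M : Matching D) (complete : Complete M) where

  matched-once : ∀ x → count (rel M x) ≤ 1
  matched-once x = count-atMostOne (rel M x) (uniqY M x)

  matched : ∀ x → 0 < count (rel M x)
  matched = sumFin-saturated (λ x → count (rel M x)) matched-once (≤-reflexive (sym complete))

  σ : Fin a → Fin a
  σ x = proj₁ (count-witness (rel M x) (matched x))

  σ-matched : ∀ x → rel M x (σ x) ≡ true
  σ-matched x = proj₂ (count-witness (rel M x) (matched x))

  σ-injective : Injective _≡_ _≡_ σ
  σ-injective {x} {x′} σx≡σx′ =
    uniqX M x x′ (σ x′) (subst (λ y → rel M x y ≡ true) σx≡σx′ (σ-matched x)) (σ-matched x′)

  τ : Fin a → Fin a
  τ y = proj₁ (injective⇒surjective σ σ-injective y)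

  σ∘τ : ∀ y → σ (τ y) ≡ y
  σ∘τ y = proj₂ (injective⇒surjective σ σ-injective y)

  τ-injective : Injective _≡_ _≡_ τ
  τ-injective {y} {y′} τy≡τy′ = trans (sym (σ∘τ y)) (trans (cong σ τy≡τy′) (σ∘τ y′))

lastOf : ∀ {A : Set} → A → List A → A
lastOf p []       = p
lastOf p (q ∷ qs) = lastOf q qs

lastOf-snoc : ∀ {A : Set} (p : A) qs j → lastOf p (qs ++ j ∷ []) ≡ j
lastOf-snoc p []       j = refl
lastOf-snoc p (q ∷ qs) j = lastOf-snoc q qs j

lastOf-∈ : ∀ {A : Set} (p : A) ps → lastOf p ps ∈ p ∷ ps
lastOf-∈ p []       = here refl
lastOf-∈ p (q ∷ ps) = there (lastOf-∈ q ps)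

lastOf-suffix : ∀ {A : Set} (p : A) ps xs j B → p ∷ ps ≡ xs ++ j ∷ B →
  lastOf p ps ≡ lastOf j B
lastOf-suffix p ps       []       j B refl = refl
lastOf-suffix p []       (x ∷ []) j B ()
lastOf-suffix p (q ∷ ps) (x ∷ xs) j B eq   = lastOf-suffix q ps xs j B (∷-injectiveʳ eq)

module _ {A : Set} {R : A → A → Set} where

  Linked-prefix : ∀ xs {ys} → Linked R (xs ++ ys) → Linked R xs
  Linked-prefix []           _        = []
  Linked-prefix (x ∷ [])     _        = [-]
  Linked-prefix (x ∷ y ∷ xs) (r ∷ rs) = r ∷ Linked-prefix (y ∷ xs) rs

  Linked-suffix : ∀ xs {ys} → Linked R (xs ++ ys) → Linked R ys
  Linked-suffix []       rs = rs
  Linked-suffix (x ∷ xs) rs = Linked-suffix xs (Linked.tail rs)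

  Linked-snoc : ∀ p ps {j} → Linked R (p ∷ ps) → R (lastOf p ps) j →
    Linked R (p ∷ ps ++ j ∷ [])
  Linked-snoc p []       _        r = r ∷ [-]
  Linked-snoc p (q ∷ ps) (r ∷ rs) r′ = r ∷ Linked-snoc q ps rs r′

Unique-prefix : ∀ {A : Set} (xs : List A) {ys} → Unique (xs ++ ys) → Unique xs
Unique-prefix []       _          = []
Unique-prefix (x ∷ xs) (x∉ ∷ uq) = AllProps.++⁻ˡ xs x∉ ∷ Unique-prefix xs uq

Unique-suffix : ∀ {A : Set} (xs : List A) {ys} → Unique (xs ++ ys) → Unique ys
Unique-suffix []       uq       = uq
Unique-suffix (x ∷ xs) (_ ∷ uq) = Unique-suffix xs uq

∈-take : ∀ {A : Set} t (xs : List A) j ys → length xs < t → j ∈ take t (xs ++ j ∷ ys)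
∈-take (suc t) []       j ys _           = here refl
∈-take (suc t) (x ∷ xs) j ys (s≤s short) = there (∈-take t xs j ys short)

length-take-++ : ∀ {A : Set} t (xs ys : List A) → length (take t xs ++ ys) ≤ t + length ys
length-take-++ t xs ys = begin
  length (take t xs ++ ys)      ≡⟨ length-++ (take t xs) ⟩
  length (take t xs) + length ys ≡⟨ cong (_+ length ys) (length-take t xs) ⟩
  (t ⊓ length xs) + length ys    ≤⟨ +-monoˡ-≤ (length ys) (m⊓n≤m t (length xs)) ⟩
  t + length ys                  ∎
  where open ≤-Reasoning

finite-choice : ∀ {n} {A : Set} {B : Fin n → Set} → (∀ j → A ⊎ B j) → A ⊎ (∀ j → B j)
finite-choice {zero}  f = inj₂ (λ ())
finite-choice {suc n} f with f zero | finite-choice (λ j → f (suc j))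
... | inj₁ x  | _       = inj₁ x
... | inj₂ _  | inj₁ x  = inj₁ x
... | inj₂ b₀ | inj₂ bs = inj₂ λ { zero → b₀ ; (suc j) → bs j }

-- Paths and cycles in an auxiliary digraph on Fin n (loops allowed),
-- given by its Boolean adjacency h.
module Paths {n : ℕ} (h : Fin n → Fin n → Bool) where

  Edge : Fin n → Fin n → Set
  Edge i j = h i j ≡ true

  record Path (E : List (Fin n)) : Set where
    constructor path
    field
      start  : Fin n
      rest   : List (Fin n)
      unique : Unique (start ∷ rest)
      linked : Linked Edge (start ∷ rest)
      avoids : All (_∉ E) (start ∷ rest)

    vertices : List (Fin n)
    vertices = start ∷ rest

    end : Fin n
    end = lastOf start rest

  record MaximalPath (E : List (Fin n)) : Set where
    field
      base : Path E
    open Path base public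
    field
      in-closed  : ∀ j → j ∉ E → Edge j start → j ∈ vertices
      out-closed : ∀ j → j ∉ E → Edge end j → j ∈ vertices

  record Cycle : Set where
    field
      root   : Fin n
      rest   : List (Fin n)
      unique : Unique (root ∷ rest)
      linked : Linked Edge (root ∷ rest ++ root ∷ [])

  cycleLength : Cycle → ℕ
  cycleLength C = suc (length (Cycle.rest C))

  LongCycle : ℕ → Set
  LongCycle t = ∃ λ (C : Cycle) → t < cycleLength C

  single : ∀ {E} v → v ∉ E → Path E
  single v v∉E = path v [] ([] ∷ []) [-] (v∉E ∷ [])

  extend-front : ∀ {E} (P : Path E) j → j ∉ E → Edge j (Path.start P) →
    j ∉ Path.vertices P → Path E
  extend-front (path s ps uq ln av) j j∉E e j∉P =
    path j (s ∷ ps) (AllProps.¬Any⇒All¬ _ j∉P ∷ uq) (e ∷ ln) (j∉E ∷ av)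

  extend-back : ∀ {E} (P : Path E) j → j ∉ E → Edge (Path.end P) j →
    j ∉ Path.vertices P → Path E
  extend-back (path s ps uq ln av) j j∉E e j∉P = path s (ps ++ j ∷ [])
    (UniqueProps.++⁺ {xs = s ∷ ps} uq ([] ∷ []) λ { (j∈P , here refl) → j∉P j∈P })
    (Linked-snoc s ps ln e) (AllProps.++⁺ av (j∉E ∷ []))

  -- Termination measure: the number of vertices outside a list.
  missing : List (Fin n) → ℕ
  missing L = count (λ j → not (j ∈ᵇ L))

  missing-shrinks : ∀ {L L′} j → (∀ {i} → i ∈ L → i ∈ L′) → j ∈ L′ → j ∉ L →
    missing L′ < missing L
  missing-shrinks {L} {L′} j L⊆L′ j∈L′ j∉L =
    count-strict outside-L′⇒outside-L j (cong not (dec-true (j ∈? L′) j∈L′))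
      (cong not (dec-false (j ∈? L) j∉L))
    where
    outside-L′⇒outside-L : ∀ i → not (i ∈ᵇ L′) ≡ true → not (i ∈ᵇ L) ≡ true
    outside-L′⇒outside-L i i∉ᵇL′ with i ∈? L | i ∈? L′
    ... | no _    | _       = refl
    ... | yes i∈L | no i∉L′ = ⊥-elim (i∉L′ (L⊆L′ i∈L))

  maximize : ∀ {E} (fuel : ℕ) (P : Path E) → missing (Path.vertices P) < fuel → MaximalPath E
  maximize {E} (suc fuel) P bound with front? | back?
    where
    open Path P
    front? : Dec (∃ λ j → j ∉ E × Edge j start × j ∉ vertices)
    front? = any? (λ j → ¬? (j ∈? E) ×-dec (h j start ≟B true) ×-dec ¬? (j ∈? vertices))
    back? : Dec (∃ λ j → j ∉ E × Edge end j × j ∉ vertices)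
    back? = any? (λ j → ¬? (j ∈? E) ×-dec (h end j ≟B true) ×-dec ¬? (j ∈? vertices))
  ... | yes (j , j∉E , e , j∉P) | _ = maximize fuel (extend-front P j j∉E e j∉P)
    (≤-trans (missing-shrinks j there (here refl) j∉P) (≤-pred bound))
  ... | no _ | yes (j , j∉E , e , j∉P) = maximize fuel (extend-back P j j∉E e j∉P)
    (≤-trans (missing-shrinks j ∈-++⁺ˡ (∈-++⁺ʳ (Path.vertices P) (here refl)) j∉P)
      (≤-pred bound))
  ... | no no-front | no no-back = record
    { base       = P
    ; in-closed  = λ j j∉E e → decidable-stable (j ∈? Path.vertices P)
                     (λ j∉P → no-front (j , j∉E , e , j∉P))
    ; out-closed = λ j j∉E e → decidable-stable (j ∈? Path.vertices P)
                     (λ j∉P → no-back (j , j∉E , e , j∉P))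
    }

  maximal-path : ∀ {E} v → v ∉ E → MaximalPath E
  maximal-path v v∉E = maximize (suc n) (single v v∉E) (s≤s (count≤ _))

  close-at-start : ∀ p ps A j B → p ∷ ps ≡ A ++ j ∷ B → Unique (p ∷ ps) →
    Linked Edge (p ∷ ps) → Edge j p → ∃ λ C → cycleLength C ≡ suc (length A)
  close-at-start p .B [] .p B refl _ _ e = record
    { root = p ; rest = [] ; unique = [] ∷ [] ; linked = e ∷ [-] } , refl
  close-at-start p .(A ++ j ∷ B) (.p ∷ A) j B refl uq ln e = record
    { root   = p
    ; rest   = A ++ j ∷ []
    ; unique = Unique-prefix (p ∷ A ++ j ∷ []) (subst Unique reassoc uq)
    ; linked = Linked-snoc p (A ++ j ∷ [])
        (Linked-prefix (p ∷ A ++ j ∷ []) (subst (Linked Edge) reassoc ln))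
        (subst (λ v → Edge v p) (sym (lastOf-snoc p A j)) e)
    } , cong suc (trans (length-++ A) (+-comm (length A) 1))
    where
    reassoc : p ∷ A ++ j ∷ B ≡ p ∷ (A ++ j ∷ []) ++ B
    reassoc = cong (p ∷_) (sym (++-assoc A (j ∷ []) B))

  close-at-end : ∀ p ps A j B → p ∷ ps ≡ A ++ j ∷ B → Unique (p ∷ ps) →
    Linked Edge (p ∷ ps) → Edge (lastOf p ps) j → ∃ λ C → cycleLength C ≡ suc (length B)
  close-at-end p ps A j B split uq ln e = record
    { root   = j
    ; rest   = B
    ; unique = Unique-suffix A (subst Unique split uq)
    ; linked = Linked-snoc j B (Linked-suffix A (subst (Linked Edge) split ln))
        (subst (λ v → Edge v j) (lastOf-suffix p ps A j B split) e)
    } , refl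

  module _ {E : List (Fin n)} (P : MaximalPath E) (t : ℕ) where
    open MaximalPath P

    start-closing : ∀ j → j ∉ E → Edge j start → LongCycle t ⊎ j ∈ take t vertices
    start-closing j j∉E e with ∈-∃++ (in-closed j j∉E e)
    ... | A , B , split with t ≤? length A
    ...   | yes far = let C , len = close-at-start start rest A j B split unique linked e
                      in inj₁ (C , ≤-trans (s≤s far) (≤-reflexive (sym len)))
    ...   | no near = inj₂ (subst (λ L → j ∈ take t L) (sym split) (∈-take t A j B (≰⇒> near)))

    end-closing : ∀ j → j ∉ E → Edge end j → LongCycle t ⊎ j ∈ take t (reverse vertices)
    end-closing j j∉E e with ∈-∃++ (out-closed j j∉E e)
    ... | A , B , split with t ≤? length B
    ...   | yes far = let C , len = close-at-end start rest A j B split unique linked e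
                      in inj₁ (C , ≤-trans (s≤s far) (≤-reflexive (sym len)))
    ...   | no near = inj₂ (subst (λ L → j ∈ take t L) (sym reversed)
                  (∈-take t (reverse B) j (reverse A)
                    (subst (_< t) (sym (length-reverse B)) (≰⇒> near))))
      where
      reversed : reverse vertices ≡ reverse B ++ j ∷ reverse A
      reversed = begin
        reverse vertices              ≡⟨ cong reverse split ⟩
        reverse (A ++ j ∷ B)          ≡⟨ reverse-++ A (j ∷ B) ⟩
        reverse (j ∷ B) ++ reverse A  ≡⟨ cong (_++ reverse A) (unfold-reverse j B) ⟩
        (reverse B ++ j ∷ []) ++ reverse A ≡⟨ ++-assoc (reverse B) (j ∷ []) (reverse A) ⟩
        reverse B ++ j ∷ reverse A    ∎
        where open ≡-Reasoning

    neighbours-within : (adj : Fin n → Bool) (L : List (Fin n)) →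
      (∀ j → j ∉ E → adj j ≡ true → LongCycle t ⊎ j ∈ L) →
      LongCycle t ⊎ (∀ j → adj j ≡ true → j ∈ L ++ E)
    neighbours-within adj L closing = finite-choice one
      where
      one : ∀ j → LongCycle t ⊎ (adj j ≡ true → j ∈ L ++ E)
      one j with j ∈? E | adj j in adj-j
      ... | yes j∈E | _     = inj₂ (λ _ → ∈-++⁺ʳ L j∈E)
      ... | no _    | false = inj₂ (λ ())
      ... | no j∉E  | true  = map₂ (λ j∈L _ → ∈-++⁺ˡ j∈L) (closing j j∉E adj-j)

    near-start : LongCycle t ⊎ (∀ j → Edge j start → j ∈ take t vertices ++ E)
    near-start = neighbours-within (λ j → h j start) _ start-closing

    near-end : LongCycle t ⊎ (∀ j → Edge end j → j ∈ take t (reverse vertices) ++ E)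
    near-end = neighbours-within (h end) _ end-closing

OnFrom OffFrom : List Bool → Set
OnFrom  []       = ⊤
OnFrom  (b ∷ bs) = b ≡ true × OffFrom bs
OffFrom []       = ⊤
OffFrom (b ∷ bs) = b ≡ false × OnFrom bs

OnFrom⇒Alternating  : ∀ bs → OnFrom bs → Alternating bs
OffFrom⇒Alternating : ∀ bs → OffFrom bs → Alternating bs
OnFrom⇒Alternating  []           _ = tt
OnFrom⇒Alternating  (b ∷ [])     _ = tt
OnFrom⇒Alternating  (b ∷ c ∷ bs) (refl , off@(refl , _)) =
  (λ ()) , OffFrom⇒Alternating (c ∷ bs) off
OffFrom⇒Alternating []           _ = tt
OffFrom⇒Alternating (b ∷ [])     _ = tt
OffFrom⇒Alternating (b ∷ c ∷ bs) (refl , on@(refl , _))  =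
  (λ ()) , OnFrom⇒Alternating (c ∷ bs) on

-- A path or cycle in H
-- expands, by inserting each matched partner σ i after i, into an
-- M-compatible path or cycle of D of twice the length.
module Contraction {a : ℕ} {D : BDigraph a} (M : Matching D) (complete : Complete M) where
  open Perfect M complete public

  H : Fin a → Fin a → Bool
  H i j = yx D (σ i) j

  open Paths H public

  expand : List (Fin a) → List (Vtx a)
  expand []       = []
  expand (p ∷ ps) = inj₁ p ∷ inj₂ (σ p) ∷ expand ps

  length-expand : ∀ ps → length (expand ps) ≡ 2 * length ps
  length-expand []       = refl
  length-expand (p ∷ ps) =
    trans (cong (2 +_) (length-expand ps)) (sym (*-distribˡ-+ 2 1 (length ps)))

  Unique-expand : ∀ ps → Unique ps → Unique (expand ps)
  Unique-expand []       []          = []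
  Unique-expand (p ∷ ps) (p∉ps ∷ uq) =
    ((λ ()) ∷ x-fresh ps p∉ps) ∷ y-fresh ps p∉ps ∷ Unique-expand ps uq
    where
    x-fresh : ∀ qs → All (p ≢_) qs → All (inj₁ p ≢_) (expand qs)
    x-fresh []       []           = []
    x-fresh (q ∷ qs) (p≢q ∷ rest) = (λ { refl → p≢q refl }) ∷ (λ ()) ∷ x-fresh qs rest
    y-fresh : ∀ qs → All (p ≢_) qs → All (inj₂ (σ p) ≢_) (expand qs)
    y-fresh []       []           = []
    y-fresh (q ∷ qs) (p≢q ∷ rest) =
      (λ ()) ∷ (λ σp≡σq → p≢q (σ-injective (inj₂-injective σp≡σq))) ∷ y-fresh qs rest

  -- Every step of an expanded H-path is an arc of D: matched arcs x_p → σ p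
  -- alternate with the arcs σ p → x_q witnessing the H-edges p → q.
  arcs-path : ∀ p qs → Linked Edge (p ∷ qs) → All (ArcAt D) (steps (expand (p ∷ qs)))
  arcs-path p []       _        = sub M p (σ p) (σ-matched p) ∷ []
  arcs-path p (q ∷ qs) (e ∷ ln) = sub M p (σ p) (σ-matched p) ∷ e ∷ arcs-path q qs ln

  arcs-closed : ∀ p qs z → Linked Edge (p ∷ qs ++ z ∷ []) →
    All (ArcAt D) (steps (expand (p ∷ qs) ++ inj₁ z ∷ []))
  arcs-closed p []       z (e ∷ _)  = sub M p (σ p) (σ-matched p) ∷ e ∷ []
  arcs-closed p (q ∷ qs) z (e ∷ ln) = sub M p (σ p) (σ-matched p) ∷ e ∷ arcs-closed q qs z ln

  in-M-path : ∀ p qs → OnFrom (map (inMAt M) (steps (expand (p ∷ qs))))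
  in-M-path p []       = σ-matched p , tt
  in-M-path p (q ∷ qs) = σ-matched p , refl , in-M-path q qs

  in-M-closed : ∀ c p qs z →
    OnFrom (map (inMAt M) (steps (expand (p ∷ qs) ++ inj₁ z ∷ []) ++ (inj₁ c , inj₂ (σ c)) ∷ []))
  in-M-closed c p []       z = σ-matched p , refl , σ-matched c , tt
  in-M-closed c p (q ∷ qs) z = σ-matched p , refl , in-M-closed c q qs z

  expand-ends : ∀ p qs → ∃ λ vs → expand (p ∷ qs) ≡ inj₁ p ∷ vs ++ inj₂ (σ (lastOf p qs)) ∷ []
  expand-ends p []       = [] , refl
  expand-ends p (q ∷ qs) =
    let vs , eq = expand-ends q qs in inj₂ (σ p) ∷ inj₁ q ∷ vs , cong (λ us → inj₁ p ∷ inj₂ (σ p) ∷ us) eq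

  path⇒MPath : ∀ {E} (P : Path E) →
    MPathFromTo D M (inj₁ (Path.start P)) (inj₂ (σ (Path.end P)))
  path⇒MPath (path s ps uq ln _) = let vs , eq = expand-ends s ps in vs ,
    subst (IsMPath D M) eq
      (Unique-expand (s ∷ ps) uq , arcs-path s ps ln , OnFrom⇒Alternating _ (in-M-path s ps))

  cycle⇒MCycle : (C : Cycle) → ∃ λ cs → IsMCycle D M cs × length cs ≡ 2 * cycleLength C
  cycle⇒MCycle C = expand (root ∷ rest) ,
    (Unique-expand (root ∷ rest) unique , arcs-closed root rest root linked ,
      OnFrom⇒Alternating _ (in-M-closed root root rest root)) ,
    length-expand (root ∷ rest)
    where open Cycle C

DegreeCondition : ∀ {a} (D : BDigraph a) → Matching D → Set
DegreeCondition {a} D M = (x₁ x₂ y₁ y₂ : Fin a) → x₁ ≢ x₂ → y₁ ≢ y₂ →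
  MPathFromTo D M (inj₁ x₁) (inj₂ y₁) → MPathFromTo D M (inj₁ x₂) (inj₂ y₂) →
  6 * a + 2 ≤ deg D (inj₁ x₁) + deg D (inj₂ y₁) + deg D (inj₁ x₂) + deg D (inj₂ y₂)

sum-with-slack : ∀ {t c₁ c₂ c₃ c₄ u₁ u₂ u₃ u₄} →
  c₁ ≤ t + u₁ → c₂ ≤ t + u₂ → c₃ ≤ t + u₃ → c₄ ≤ t + u₄ → u₁ + u₂ + u₃ + u₄ ≤ 2 →
  c₁ + c₂ + c₃ + c₄ ≤ 4 * t + 2
sum-with-slack {t} {c₁} {c₂} {c₃} {c₄} {u₁} {u₂} {u₃} {u₄} b₁ b₂ b₃ b₄ slack = begin
  c₁ + c₂ + c₃ + c₄                              ≤⟨ +-mono-≤ (+-mono-≤ (+-mono-≤ b₁ b₂) b₃) b₄ ⟩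
  (t + u₁) + (t + u₂) + (t + u₃) + (t + u₄)      ≡⟨ regroup t u₁ u₂ u₃ u₄ ⟩
  4 * t + (u₁ + u₂ + u₃ + u₄)                    ≤⟨ +-monoʳ-≤ (4 * t) slack ⟩
  4 * t + 2                                      ∎
  where
  open ≤-Reasoning
  regroup : ∀ t u₁ u₂ u₃ u₄ →
    (t + u₁) + (t + u₂) + (t + u₃) + (t + u₄) ≡ 4 * t + (u₁ + u₂ + u₃ + u₄)
  regroup = solve-∀

module Degrees {a : ℕ} {D : BDigraph a} (M : Matching D) (complete : Complete M) where
  open Contraction M complete public

  -- The in-arcs of x_s and the out-arcs of σ e are the parts of their
  -- degrees not trivially bounded by a; the latter are H-out-edges of e.
  in-x : Fin a → ℕ
  in-x s = count (λ y → yx D y s)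

  out-σ : Fin a → ℕ
  out-σ e = count (H e)

  deg-x≤ : ∀ s → deg D (inj₁ s) ≤ a + in-x s
  deg-x≤ s = +-monoˡ-≤ (in-x s) (count≤ _)

  deg-σ≤ : ∀ e → deg D (inj₂ (σ e)) ≤ out-σ e + a
  deg-σ≤ e = +-monoʳ-≤ (out-σ e) (count≤ _)

  sparse-pair : DegreeCondition D M → ∀ s₁ e₁ s₂ e₂ → s₁ ≢ s₂ → e₁ ≢ e₂ →
    MPathFromTo D M (inj₁ s₁) (inj₂ (σ e₁)) → MPathFromTo D M (inj₁ s₂) (inj₂ (σ e₂)) →
    in-x s₁ + out-σ e₁ + in-x s₂ + out-σ e₂ ≤ 2 * a → ⊥
  sparse-pair cond s₁ e₁ s₂ e₂ s₁≢s₂ e₁≢e₂ path₁ path₂ sparse =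
    <-irrefl refl (begin-strict
      6 * a                  <⟨ m<m+n (6 * a) (s≤s z≤n) ⟩
      6 * a + 2              ≤⟨ cond s₁ s₂ (σ e₁) (σ e₂) s₁≢s₂ (λ eq → e₁≢e₂ (σ-injective eq)) path₁ path₂ ⟩
      deg D (inj₁ s₁) + deg D (inj₂ (σ e₁)) + deg D (inj₁ s₂) + deg D (inj₂ (σ e₂))
        ≤⟨ +-mono-≤ (+-mono-≤ (+-mono-≤ (deg-x≤ s₁) (deg-σ≤ e₁)) (deg-x≤ s₂)) (deg-σ≤ e₂) ⟩
      (a + i₁) + (o₁ + a) + (a + i₂) + (o₂ + a)  ≡⟨ regroup a i₁ o₁ i₂ o₂ ⟩
      4 * a + (i₁ + o₁ + i₂ + o₂)                ≤⟨ +-monoʳ-≤ (4 * a) sparse ⟩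
      4 * a + 2 * a                              ≡⟨ sym (*-distribʳ-+ a 4 2) ⟩
      6 * a                                      ∎)
    where
    open ≤-Reasoning
    i₁ o₁ i₂ o₂ : ℕ
    i₁ = in-x s₁
    o₁ = out-σ e₁
    i₂ = in-x s₂
    o₂ = out-σ e₂
    regroup : ∀ a i₁ o₁ i₂ o₂ →
      (a + i₁) + (o₁ + a) + (a + i₂) + (o₂ + a) ≡ 4 * a + (i₁ + o₁ + i₂ + o₂)
    regroup = solve-∀

  -- A maximal path avoiding E without a cycle longer than t has start
  -- in-degree and end out-degree at most t + |E|: all in-neighbours of the
  -- start lie in its first t vertices or in E, and dually.
  Bounded : ∀ {E} → MaximalPath E → ℕ → Set
  Bounded {E} P t =
    in-x (MaximalPath.start P) ≤ t + length E × out-σ (MaximalPath.end P) ≤ t + length E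

  bounded : ∀ {E} (P : MaximalPath E) t → LongCycle t ⊎ Bounded P t
  bounded {E} P t with near-start P t | near-end P t
  ... | inj₁ long | _         = inj₁ long
  ... | inj₂ _    | inj₁ long = inj₁ long
  ... | inj₂ near-s | inj₂ near-e = inj₂ (start-bound , end-bound)
    where
    open MaximalPath P
    start-bound : in-x start ≤ t + length E
    start-bound = ≤-trans
      (count≤length τ τ-injective (take t vertices ++ E)
        (λ y y→s → near-s (τ y) (subst (λ z → yx D z start ≡ true) (sym (σ∘τ y)) y→s)))
      (length-take-++ t vertices E)
    end-bound : out-σ end ≤ t + length E
    end-bound = ≤-trans
      (count≤length (λ x → x) (λ eq → eq) (take t (reverse vertices) ++ E) near-e)
      (length-take-++ t (reverse vertices) E)

  -- Main argument (for a ≥ 2, which supplies v₀ and `another`; t + t < a):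
  -- take a maximal path P, a maximal path Q avoiding the start of P and a
  -- maximal path R avoiding the end of P.  If no cycle is longer than t, two of P, Q, R have
  -- distinct starts and distinct ends with degree bounds summing to at
  -- most 4t + 2 ≤ 2a, contradicting the degree condition.
  long-cycle : DegreeCondition D M → ∀ t → t + t < a → Fin a →
    (∀ (v : Fin a) → ∃ λ w → w ≢ v) → LongCycle t
  long-cycle cond t small v₀ another = search (maximal-path v₀ (λ ()))
    where
    open MaximalPath

    avoiding : ∀ v → MaximalPath (v ∷ [])
    avoiding v = maximal-path (proj₁ (another v)) (λ { (here eq) → proj₂ (another v) eq })

    start-avoids : ∀ {v} (Q : MaximalPath (v ∷ [])) → start Q ≢ v
    start-avoids Q eq = All.head (avoids Q) (here eq)

    end-avoids : ∀ {v} (Q : MaximalPath (v ∷ [])) → end Q ≢ v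
    end-avoids Q eq = All.lookup (avoids Q) (lastOf-∈ (start Q) (rest Q)) (here eq)

    clash : ∀ {E₁ E₂ u₁ u₂ u₃ u₄} (P : MaximalPath E₁) (Q : MaximalPath E₂) →
      start P ≢ start Q → end P ≢ end Q →
      in-x (start P) ≤ t + u₁ → out-σ (end P) ≤ t + u₂ →
      in-x (start Q) ≤ t + u₃ → out-σ (end Q) ≤ t + u₄ → u₁ + u₂ + u₃ + u₄ ≤ 2 → ⊥
    clash {u₁ = u₁} {u₂} {u₃} {u₄} P Q s≢ e≢ b₁ b₂ b₃ b₄ slack =
      sparse-pair cond (start P) (end P) (start Q) (end Q) s≢ e≢
        (path⇒MPath (base P)) (path⇒MPath (base Q))
        (≤-trans (sum-with-slack {t} {u₁ = u₁} {u₂} {u₃} {u₄} b₁ b₂ b₃ b₄ slack) four-t+2≤2a)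
      where
      four-t+2≤2a : 4 * t + 2 ≤ 2 * a
      four-t+2≤2a = ≤-trans (≤-reflexive (double t)) (*-monoʳ-≤ 2 small)
        where
        double : ∀ t → 4 * t + 2 ≡ 2 * suc (t + t)
        double = solve-∀

    three-paths : (P : MaximalPath []) (Q : MaximalPath (start P ∷ []))
      (R : MaximalPath (end P ∷ [])) → Bounded P t → Bounded Q t → Bounded R t → ⊥
    three-paths P Q R (P-in , P-out) (Q-in , Q-out) (R-in , R-out)
      with end Q ≟F end P | start R ≟F start P
    ... | no Qe≢Pe  | _         =
      clash P Q (start-avoids Q ∘ sym) (Qe≢Pe ∘ sym) P-in P-out Q-in Q-out ≤-refl
    ... | yes _     | no Rs≢Ps  =
      clash P R (Rs≢Ps ∘ sym) (end-avoids R ∘ sym) P-in P-out R-in R-out ≤-refl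
    ... | yes Qe≡Pe | yes Rs≡Ps =
      clash Q R (λ eq → start-avoids Q (trans eq Rs≡Ps))
        (λ eq → end-avoids R (trans (sym eq) Qe≡Pe))
        Q-in (subst (λ e → out-σ e ≤ t + 0) (sym Qe≡Pe) P-out)
        (subst (λ s → in-x s ≤ t + 0) (sym Rs≡Ps) P-in) R-out ≤-refl

    search : MaximalPath [] → LongCycle t
    search P with bounded P t | bounded (avoiding (start P)) t | bounded (avoiding (end P)) t
    ... | inj₁ long | _         | _         = long
    ... | inj₂ _    | inj₁ long | _         = long
    ... | inj₂ _    | inj₂ _    | inj₁ long = long
    ... | inj₂ bP   | inj₂ bQ   | inj₂ bR   =
      ⊥-elim (three-paths P (avoiding (start P)) (avoiding (end P)) bP bQ bR)

halving : ∀ k → ∃ λ t → t + t ≤ k × k ≤ suc (t + t)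
halving zero          = 0 , z≤n , z≤n
halving (suc zero)    = 0 , z≤n , s≤s z≤n
halving (suc (suc k)) with t , lo , hi ← halving k =
  suc t , subst (_≤ suc (suc k)) (sym (cong suc (+-suc t t))) (s≤s (s≤s lo)) ,
          subst (suc (suc k) ≤_) (sym (cong (λ n → suc (suc n)) (+-suc t t))) (s≤s (s≤s hi))

-- For every a ≥ 2 (in particular in the case a ≥ 3 of the theorem): with
-- t = ⌊(a - 1)/2⌋, the contraction has a cycle of length > t, whose
-- expansion is an M-compatible cycle of length ≥ 2(t + 1) ≥ a.
long-M-cycle : ∀ {a} → 2 ≤ a → (D : BDigraph a) (M : Matching D) → Complete M →
  DegreeCondition D M → ∃ λ cs → IsMCycle D M cs × a ≤ length cs
long-M-cycle {suc zero} (s≤s ()) D M complete cond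
long-M-cycle {suc k@(suc _)} _ D M complete cond =
  expand-long (long-cycle cond t (s≤s t+t≤k) zero another)
  where
  open Degrees M complete
  t : ℕ
  t = proj₁ (halving k)
  t+t≤k : t + t ≤ k
  t+t≤k = proj₁ (proj₂ (halving k))
  k≤1+t+t : k ≤ suc (t + t)
  k≤1+t+t = proj₂ (proj₂ (halving k))

  another : ∀ (v : Fin (suc k)) → ∃ λ w → w ≢ v
  another zero    = suc zero , λ ()
  another (suc _) = zero , λ ()

  expand-long : LongCycle t → ∃ λ cs → IsMCycle D M cs × suc k ≤ length cs
  expand-long (C , t<ℓ) with cs , is-cycle , length≡ ← cycle⇒MCycle C =
    cs , is-cycle , (begin
      suc k             ≤⟨ s≤s k≤1+t+t ⟩
      suc (suc (t + t)) ≡⟨ cong suc (sym (+-suc t t)) ⟩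
      suc t + suc t     ≤⟨ +-mono-≤ t<ℓ (≤-trans t<ℓ (m≤m+n _ 0)) ⟩
      2 * cycleLength C ≡⟨ sym length≡ ⟩
      length cs         ∎)
    where open ≤-Reasoning

matching-of : ∀ {a} (D : BDigraph a) (π : Fin a → Fin a) → Injective _≡_ _≡_ π →
  (∀ x → xy D x (π x) ≡ true) → Matching D
matching-of D π π-injective arcs = record
  { rel   = λ x y → does (π x ≟F y)
  ; sub   = λ x y r → subst (λ z → xy D x z ≡ true) (decided (π x ≟F y) r) (arcs x)
  ; uniqY = λ x y y′ r r′ → trans (sym (decided (π x ≟F y) r)) (decided (π x ≟F y′) r′)
  ; uniqX = λ x x′ y r r′ →
      π-injective (trans (decided (π x ≟F y) r) (sym (decided (π x′ ≟F y) r′)))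
  }
  where
  decided : ∀ {A : Set} (d : Dec A) → does d ≡ true → A
  decided (yes a) _ = a

present : List Bool → ℕ
present bs = sum (map b2n bs)

present≤length : ∀ bs → present bs ≤ length bs
present≤length []       = z≤n
present≤length (b ∷ bs) = +-mono-≤ (b2n≤1 b) (present≤length bs)

all-present : ∀ bs → length bs ≤ present bs → All (_≡ true) bs
all-present []           _        = []
all-present (true ∷ bs)  (s≤s le) = refl ∷ all-present bs le
all-present (false ∷ bs) le       = ⊥-elim (<-irrefl refl (≤-trans le (present≤length bs)))

-- The case a = 2.  The two 4-cycles x₀ → π 0 → x₁ → π 1 → x₀ for π the
-- identity and the transposition use each of the 8 possible arcs exactly
-- once, so the degree sum of all four vertices is twice the number of arcs
-- present on them.  The degree condition forces ≥ 7 of the 8 arcs, hence one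
-- of the two cycles is complete, and it is compatible with the matching π.
module TwoByTwo (D : BDigraph 2) where

  swap : Fin 2 → Fin 2
  swap zero       = suc zero
  swap (suc zero) = zero

  swap-injective : Injective _≡_ _≡_ swap
  swap-injective {zero}     {zero}     _ = refl
  swap-injective {suc zero} {suc zero} _ = refl
  swap-injective {zero}     {suc zero} ()
  swap-injective {suc zero} {zero}     ()

  cycle-arcs : (Fin 2 → Fin 2) → List Bool
  cycle-arcs π = xy D zero (π zero) ∷ yx D (π zero) (suc zero)
               ∷ xy D (suc zero) (π (suc zero)) ∷ yx D (π (suc zero)) zero ∷ []

  four-cycle : (π : Fin 2 → Fin 2) (π-injective : Injective _≡_ _≡_ π) →
    All (_≡ true) (cycle-arcs π) →
    ∃ λ (M′ : Matching D) → ∃ λ cs → IsMCycle D M′ cs × length cs ≡ 4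
  four-cycle π π-injective (x₀→ ∷ →x₁ ∷ x₁→ ∷ →x₀ ∷ []) =
    matching-of D π π-injective matched ,
    inj₁ zero ∷ inj₂ (π zero) ∷ inj₁ (suc zero) ∷ inj₂ (π (suc zero)) ∷ [] ,
    (distinct , x₀→ ∷ →x₁ ∷ x₁→ ∷ →x₀ ∷ [] ,
      OnFrom⇒Alternating _ (on zero , refl , on (suc zero) , refl , on zero , tt)) ,
    refl
    where
    matched : ∀ x → xy D x (π x) ≡ true
    matched zero       = x₀→
    matched (suc zero) = x₁→
    on : ∀ x → does (π x ≟F π x) ≡ true
    on x = dec-true (π x ≟F π x) refl
    distinct : Unique (inj₁ zero ∷ inj₂ (π zero) ∷ inj₁ (suc zero) ∷ inj₂ (π (suc zero)) ∷ [])
    distinct = ((λ ()) ∷ (λ ()) ∷ (λ ()) ∷ [])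
             ∷ ((λ ()) ∷ (λ eq → 0≢1 (π-injective (inj₂-injective eq))) ∷ [])
             ∷ ((λ ()) ∷ []) ∷ [] ∷ []
      where
      0≢1 : zero ≢ suc zero
      0≢1 ()

  -- Handshake identity: with arc indicators p = x₀→y₀, q = x₀→y₁,
  -- r = x₁→y₀, s = x₁→y₁, u = y₀→x₀, v = y₀→x₁, w = y₁→x₀, z = y₁→x₁, the
  -- degree sum deg x₀ + deg y₀ + deg x₁ + deg y₁ counts every arc twice.
  count-twice : ∀ p q r s u v w z →
    ((p + (q + 0)) + (u + (w + 0))) + ((u + (v + 0)) + (p + (r + 0)))
      + ((r + (s + 0)) + (v + (z + 0))) + ((w + (z + 0)) + (q + (s + 0)))
    ≡ 2 * ((p + (v + (s + (w + 0)))) + (q + (z + (r + (u + 0)))))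
  count-twice = solve-∀

  all-arcs :
    deg D (inj₁ zero) + deg D (inj₂ zero) + deg D (inj₁ (suc zero)) + deg D (inj₂ (suc zero))
      ≡ 2 * (present (cycle-arcs (λ x → x)) + present (cycle-arcs swap))
  all-arcs = count-twice (b2n (xy D zero zero)) (b2n (xy D zero (suc zero)))
    (b2n (xy D (suc zero) zero)) (b2n (xy D (suc zero) (suc zero)))
    (b2n (yx D zero zero)) (b2n (yx D zero (suc zero)))
    (b2n (yx D (suc zero) zero)) (b2n (yx D (suc zero) (suc zero)))

  handshake : ∀ y₁ y₂ → y₁ ≢ y₂ →
    deg D (inj₁ zero) + deg D (inj₂ y₁) + deg D (inj₁ (suc zero)) + deg D (inj₂ y₂)
      ≡ 2 * (present (cycle-arcs (λ x → x)) + present (cycle-arcs swap))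
  handshake zero       zero       0≢0 = ⊥-elim (0≢0 refl)
  handshake zero       (suc zero) _   = all-arcs
  handshake (suc zero) zero       _   =
    trans (exchange (deg D (inj₁ zero)) (deg D (inj₂ (suc zero)))
                    (deg D (inj₁ (suc zero))) (deg D (inj₂ zero)))
          all-arcs
    where
    exchange : ∀ d₁ d₂ d₃ d₄ → d₁ + d₂ + d₃ + d₄ ≡ d₁ + d₄ + d₃ + d₂
    exchange = solve-∀
  handshake (suc zero) (suc zero) 1≢1 = ⊥-elim (1≢1 refl)

  four-cycle-exists : (M : Matching D) → Complete M → DegreeCondition D M →
    ∃ λ (M′ : Matching D) → ∃ λ cs → IsMCycle D M′ cs × length cs ≡ 4
  four-cycle-exists M complete cond with 4 ≤? present (cycle-arcs (λ x → x))
  ... | yes id-full = four-cycle (λ x → x) (λ eq → eq) (all-present _ id-full)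
  ... | no id-short = four-cycle swap swap-injective (all-present _ (+-cancelˡ-≤ 3 4 c-swap (begin
      7                ≤⟨ seven-arcs ⟩
      c-id + c-swap    ≤⟨ +-monoˡ-≤ c-swap (≤-pred (≰⇒> id-short)) ⟩
      3 + c-swap       ∎)))
    where
    open ≤-Reasoning
    open Contraction M complete
    c-id c-swap : ℕ
    c-id   = present (cycle-arcs (λ x → x))
    c-swap = present (cycle-arcs swap)
    σ-distinct : σ zero ≢ σ (suc zero)
    σ-distinct eq = case σ-injective eq of λ ()
    matched-arc : ∀ x → MPathFromTo D M (inj₁ x) (inj₂ (σ x))
    matched-arc x = path⇒MPath (single {E = []} x (λ ()))
    seven-arcs : 7 ≤ c-id + c-swap
    seven-arcs = *-cancelˡ-≤ 2 (subst (14 ≤_) (handshake (σ zero) (σ (suc zero)) σ-distinct)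
      (cond zero (suc zero) (σ zero) (σ (suc zero)) (λ ()) σ-distinct
        (matched-arc zero) (matched-arc (suc zero))))

-- The long-cycle part holds for all a ≥ 2, so the hypothesis 3 ≤ a is unused.
lemma2p6 : (a : ℕ) → 2 ≤ a → (D : BDigraph a) → (M : Matching D) → Complete M →
    ((x₁ x₂ y₁ y₂ : Fin a) → x₁ ≢ x₂ → y₁ ≢ y₂ →
      MPathFromTo D M (inj₁ x₁) (inj₂ y₁) → MPathFromTo D M (inj₁ x₂) (inj₂ y₂) →
      6 * a + 2 ≤ deg D (inj₁ x₁) + deg D (inj₂ y₁) + deg D (inj₁ x₂) + deg D (inj₂ y₂)) →
    (3 ≤ a → ∃ λ (cs : List (Vtx a)) → IsMCycle D M cs × a ≤ length cs)
    × (a ≡ 2 → ∃ λ (M′ : Matching D) → ∃ λ (cs : List (Vtx a)) → IsMCycle D M′ cs × length cs ≡ 4)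
lemma2p6 a 2≤a D M complete cond =
  (λ _ → long-M-cycle 2≤a D M complete cond) ,
  λ { refl → TwoByTwo.four-cycle-exists D M complete cond }
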